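{- For arbitrary MSO sentences $\varphi_1,\dots,\varphi_k$ in \textsf{TOTO}, one can construct an MSO sentence $\rho$ in \textsf{TOTO} such that for every permutation $\pi$, $\pi\models\rho$ if and only if $\pi$ can be obtained as a merge of permutations $\pi_1,\dots,\pi_k$ such that $\pi_i\models\varphi_i$ for every $i\in[k]$.
   Context: A permutation $\pi$ of $[n]$ is identified with its diagram $S_\pi=\{(i,\pi_i)\}$ and viewed as the structure $(S_\pi,\prec_1,\prec_2)$ over two binary relation symbols $<_1,<_2$ interpreted as the orders by $x$- and $y$-coordinate; \textsf{TOTO} is the theory saying both are linear orders, and MSO formulas allow quantification over elements and over sets of elements with membership atoms $x\in X$. Two finite point sets in general position are isomorphic if some bijection between them preserves both the relative order of $x$-coordinates and of $y$-coordinates. A permutation $\pi$ is a merge of permutations $\pi_1,\dots,\pi_k$ if the points of $S_\pi$ can be partitioned into $k$ sets (colored with $k$ colors) so that the $i$-th set is isomorphic to $S_{\pi_i}$ for each $i$. -}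

module Defs where

open import Data.Nat using (ℕ; zero; suc)
open import Data.Fin using (Fin; zero; suc; _<_)
open import Data.Fin.Subset using (Subset; _∈_)
open import Data.Fin.Permutation using (Permutation′; _⟨$⟩ʳ_)
open import Data.Product using (Σ; _×_; _,_; proj₁)
open import Relation.Binary.PropositionalEquality using (_≡_)
open import Relation.Nullary using (¬_)
open import Function.Bundles using (_↔_; Inverse; _⇔_)

Perm : ℕ → Set
Perm n = Permutation′ n

-- MSO formulas over the signature {<₁, <₂} (plus equality and membership),
-- with m free first-order and s free second-order variables (de Bruijn).
data Formula (m s : ℕ) : Set where
  _≐_   : Fin m → Fin m → Formula m s
  _<₁_  : Fin m → Fin m → Formula m s
  _<₂_  : Fin m → Fin m → Formula m s
  _∈ˢ_  : Fin m → Fin s → Formula m s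
  ¬ᶠ_   : Formula m s → Formula m s
  _∧ᶠ_  : Formula m s → Formula m s → Formula m s
  ∃₁_   : Formula (suc m) s → Formula m s
  ∃₂_   : Formula m (suc s) → Formula m s

Sentence : Set
Sentence = Formula 0 0

extend : ∀ {A : Set} {m} → A → (Fin m → A) → Fin (suc m) → A
extend a f zero    = a
extend a f (suc i) = f i

-- Satisfaction in the structure (S_π, ≺₁, ≺₂): the point (i, π i) is
-- identified with i; i ≺₁ j iff i < j, i ≺₂ j iff π i < π j.
Sat : ∀ {n m s} → Perm n → (Fin m → Fin n) → (Fin s → Subset n) → Formula m s → Set
Sat π ρ σ (x ≐ y)   = ρ x ≡ ρ y
Sat π ρ σ (x <₁ y)  = ρ x < ρ y
Sat π ρ σ (x <₂ y)  = (π ⟨$⟩ʳ ρ x) < (π ⟨$⟩ʳ ρ y)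
Sat π ρ σ (x ∈ˢ X)  = ρ x ∈ σ X
Sat π ρ σ (¬ᶠ φ)    = ¬ Sat π ρ σ φ
Sat π ρ σ (φ ∧ᶠ ψ)  = Sat π ρ σ φ × Sat π ρ σ ψ
Sat {n} π ρ σ (∃₁ φ) = Σ (Fin n) λ a → Sat π (extend a ρ) σ φ
Sat {n} π ρ σ (∃₂ φ) = Σ (Subset n) λ A → Sat π ρ (extend A σ) φ

_⊨_ : ∀ {n} → Perm n → Sentence → Set
π ⊨ φ = Sat π (λ ()) (λ ()) φ

-- Two point sets are isomorphic: a bijection preserving the relative order
-- of x-coordinates and of y-coordinates.  Here: the colour class i of π
-- (points j with c j ≡ i) is isomorphic to S_τ.
ClassIso : ∀ {n k m} → Perm n → (Fin n → Fin k) → Fin k → Perm m → Set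
ClassIso {n} π c i τ =
  Σ (Σ (Fin n) (λ j → c j ≡ i) ↔ Fin _) λ f →
    (∀ a b → (proj₁ a < proj₁ b ⇔ Inverse.to f a < Inverse.to f b)
           × ((π ⟨$⟩ʳ proj₁ a) < (π ⟨$⟩ʳ proj₁ b)
               ⇔ (τ ⟨$⟩ʳ Inverse.to f a) < (τ ⟨$⟩ʳ Inverse.to f b)))

IsMerge : ∀ {n k} (ns : Fin k → ℕ) → Perm n → ((i : Fin k) → Perm (ns i)) → Set
IsMerge {n} {k} ns π πs =
  Σ (Fin n → Fin k) λ c → (i : Fin k) → ClassIso π c i (πs i)

MergeOfModels : ∀ {n k} → Perm n → (Fin k → Sentence) → Set
MergeOfModels {n} {k} π φ =
  Σ (Fin k → ℕ) λ ns → Σ ((i : Fin k) → Perm (ns i)) λ πs →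
    IsMerge ns π πs × ((i : Fin k) → πs i ⊨ φ i)

{-# OPTIONS --safe #-}

-- The sentence guesses sets X₁,…,X_k, says that they partition the points, and
-- says that each φᵢ holds once its element quantifiers are relativised to Xᵢ.
-- If τ occurs in π with image Xᵢ (a bijection preserving both orders), the
-- relativised φᵢ holds in π iff φᵢ holds in τ: quantified sets are transported
-- by preimage and image, as only their trace on Xᵢ matters. Every colour class
-- is the image of such an occurrence: enumerate the class once from left to
-- right and once from bottom to top, and let τ relabel one enumeration into
-- the other.

module Submission where

open import Defs
open import Data.Nat using (ℕ)
open import Data.Fin using (Fin)
open import Data.Product using (Σ)
open import Function.Bundles using (_⇔_)

open import Data.Nat as ℕ using (zero; suc; _+_; z≤n; s≤s)
open import Data.Fin using (zero; suc; _<_; _↑ˡ_; lift; toℕ)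
open import Data.Fin.Properties using (_≟_; _<?_; any?; <-cmp; <-irrefl)
open import Data.Fin.Subset using (Subset; _∈_)
open import Data.Fin.Subset.Properties using (_∈?_; anySubset?)
open import Data.Fin.Permutation using (_⟨$⟩ʳ_; _⟨$⟩ˡ_; ↔⇒≡; inverseˡ; inverseʳ)
open import Data.Product using (_×_; _,_; proj₁; proj₂)
open import Data.Product.Properties using (Σ-≡,≡→≡)
open import Data.Bool.Properties using (T-≡)
open import Data.Vec using (tabulate)
open import Data.Vec.Properties using (lookup∘tabulate; []=⇒lookup; lookup⇒[]=)
open import Function using (_∘_)
open import Function.Definitions using (Injective)
open import Function.Bundles using (_↔_; Inverse; mk↔ₛ′; mk⇔; Equivalence)
open import Function.Construct.Composition using (_⇔-∘_)
open import Function.Construct.Symmetry using (⇔-sym)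
open import Function.Properties.Inverse using (↔-trans; ↔-sym)
open import Function.Related.TypeIsomorphisms using (¬-cong-⇔)
open import Relation.Binary using (tri<; tri≈; tri>)
open import Relation.Binary.PropositionalEquality
  using (_≡_; refl; sym; trans; cong; subst; subst₂)
open import Relation.Nullary using (¬_; Dec; yes; no; ¬?; _×-dec_; contradiction)
open import Relation.Nullary.Decidable using (⌊_⌋; toWitness; fromWitness; decidable-stable)
open import Relation.Unary using (Decidable; Irrelevant)
open import Axiom.UniquenessOfIdentityProofs using (module Decidable⇒UIP)

open Equivalence using () renaming (to to ⇒; from to ⇐)

Sat? : ∀ {n m s} (π : Perm n) ρ σ (φ : Formula m s) → Dec (Sat π ρ σ φ)
Sat? π ρ σ (x ≐ y)   = ρ x ≟ ρ y
Sat? π ρ σ (x <₁ y)  = ρ x <? ρ y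
Sat? π ρ σ (x <₂ y)  = (π ⟨$⟩ʳ ρ x) <? (π ⟨$⟩ʳ ρ y)
Sat? π ρ σ (x ∈ˢ X)  = ρ x ∈? σ X
Sat? π ρ σ (¬ᶠ φ)    = ¬? (Sat? π ρ σ φ)
Sat? π ρ σ (φ ∧ᶠ ψ)  = Sat? π ρ σ φ ×-dec Sat? π ρ σ ψ
Sat? π ρ σ (∃₁ φ)    = any? (λ a → Sat? π (extend a ρ) σ φ)
Sat? π ρ σ (∃₂ φ)    = anySubset? (λ A → Sat? π ρ (extend A σ) φ)

⊤ᶠ : ∀ {m s} → Formula m s
⊤ᶠ = ¬ᶠ (∃₁ (¬ᶠ (zero ≐ zero)))

⋀ : ∀ {k m s} → (Fin k → Formula m s) → Formula m s
⋀ {zero}  F = ⊤ᶠ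
⋀ {suc k} F = F zero ∧ᶠ ⋀ (F ∘ suc)

⋁ : ∀ {k m s} → (Fin k → Formula m s) → Formula m s
⋁ F = ¬ᶠ ⋀ (¬ᶠ_ ∘ F)

∀ᶠ : ∀ {m s} → Formula (suc m) s → Formula m s
∀ᶠ φ = ¬ᶠ (∃₁ (¬ᶠ φ))

unless : ∀ {P : Set} {m s} → Dec P → Formula m s → Formula m s
unless (yes _) φ = ⊤ᶠ
unless (no _)  φ = φ

-- Recursion on k, unlike Data.Vec.Functional._++_, makes ∃₂* unfold definitionally.
_++ᵉ_ : ∀ {A : Set} {k s} → (Fin k → A) → (Fin s → A) → Fin (k + s) → A
_++ᵉ_ {k = zero}  Xs σ = σ
_++ᵉ_ {k = suc k} Xs σ = extend (Xs zero) ((Xs ∘ suc) ++ᵉ σ)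

++ᵉ-↑ˡ : ∀ {A : Set} {k s} (Xs : Fin k → A) (σ : Fin s → A) i → (Xs ++ᵉ σ) (i ↑ˡ s) ≡ Xs i
++ᵉ-↑ˡ Xs σ zero    = refl
++ᵉ-↑ˡ Xs σ (suc i) = ++ᵉ-↑ˡ (Xs ∘ suc) σ i

∃₂* : ∀ {m} k s → Formula m (k + s) → Formula m s
∃₂* zero    s φ = φ
∃₂* (suc k) s φ = ∃₂* k s (∃₂ φ)

module _ {n} {π : Perm n} where

  ⊤ᶠ-sat : ∀ {m s} {ρ : Fin m → Fin n} {σ : Fin s → Subset n} → Sat π ρ σ ⊤ᶠ
  ⊤ᶠ-sat (_ , a≢a) = a≢a refl

  ⋀-sat : ∀ {k m s} {ρ : Fin m → Fin n} {σ : Fin s → Subset n} (F : Fin k → Formula m s) →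
          Sat π ρ σ (⋀ F) ⇔ (∀ i → Sat π ρ σ (F i))
  ⋀-sat {zero} {ρ = ρ} {σ} F = mk⇔ (λ _ ()) (λ _ → ⊤ᶠ-sat {ρ = ρ} {σ})
  ⋀-sat {suc k} {ρ = ρ} {σ} F = mk⇔
    (λ { (h , hs) zero → h ; (h , hs) (suc i) → ⇒ (⋀-sat (F ∘ suc)) hs i })
    (λ h → h zero , ⇐ (⋀-sat {ρ = ρ} {σ} (F ∘ suc)) (h ∘ suc))

  ⋁-sat : ∀ {k m s} {ρ : Fin m → Fin n} {σ : Fin s → Subset n} (F : Fin k → Formula m s) →
          Sat π ρ σ (⋁ F) ⇔ Σ (Fin k) (λ i → Sat π ρ σ (F i))
  ⋁-sat {ρ = ρ} {σ} F = mk⇔ witness (λ { (i , h) hs → ⇒ (⋀-sat (¬ᶠ_ ∘ F)) hs i h })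
    where
    witness : Sat π ρ σ (⋁ F) → Σ (Fin _) (λ i → Sat π ρ σ (F i))
    witness h with any? (λ i → Sat? π ρ σ (F i))
    ... | yes found = found
    ... | no none   = contradiction (⇐ (⋀-sat (¬ᶠ_ ∘ F)) (λ i hi → none (i , hi))) h

  ∀ᶠ-sat : ∀ {m s} {ρ : Fin m → Fin n} {σ : Fin s → Subset n} (φ : Formula (suc m) s) →
           Sat π ρ σ (∀ᶠ φ) ⇔ (∀ a → Sat π (extend a ρ) σ φ)
  ∀ᶠ-sat {ρ = ρ} {σ} φ = mk⇔
    (λ h a → decidable-stable (Sat? π (extend a ρ) σ φ) (λ ¬φ → h (a , ¬φ)))
    (λ h (a , ¬φ) → ¬φ (h a))

  unless-sat : ∀ {P : Set} {m s} {ρ : Fin m → Fin n} {σ : Fin s → Subset n}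
               (P? : Dec P) (φ : Formula m s) → Sat π ρ σ (unless P? φ) ⇔ (¬ P → Sat π ρ σ φ)
  unless-sat {ρ = ρ} {σ} (yes p) φ = mk⇔ (λ _ ¬p → contradiction p ¬p) (λ _ → ⊤ᶠ-sat {ρ = ρ} {σ})
  unless-sat (no ¬p) φ = mk⇔ (λ h _ → h) (λ h → h ¬p)

  ∃₂*-sat : ∀ {m} k s {ρ : Fin m → Fin n} {σ : Fin s → Subset n} (φ : Formula m (k + s)) →
            Sat π ρ σ (∃₂* k s φ) ⇔ Σ (Fin k → Subset n) (λ Xs → Sat π ρ (Xs ++ᵉ σ) φ)
  ∃₂*-sat zero    s φ = mk⇔ (λ h → (λ ()) , h) proj₂
  ∃₂*-sat (suc k) s φ = mk⇔
    (λ h → let (Xs , A , hA) = ⇒ (∃₂*-sat k s (∃₂ φ)) h in extend A Xs , hA)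
    (λ (Xs , h) → ⇐ (∃₂*-sat k s (∃₂ φ)) (Xs ∘ suc , Xs zero , h))

subset : ∀ {n} {P : Fin n → Set} → Decidable P → Subset n
subset P? = tabulate (λ j → ⌊ P? j ⌋)

∈-subset : ∀ {n} {P : Fin n → Set} (P? : Decidable P) {j} → j ∈ subset P? ⇔ P j
∈-subset P? {j} = mk⇔
  (λ j∈ → toWitness (⇐ T-≡ (trans (sym (lookup∘tabulate _ j)) ([]=⇒lookup j∈))))
  (λ p → lookup⇒[]= j _ (trans (lookup∘tabulate _ j) (⇒ T-≡ (fromWitness p))))

preimage : ∀ {m n} → (Fin m → Fin n) → Subset n → Subset m
preimage f A = subset (λ u → f u ∈? A)

image : ∀ {m n} → (Fin m → Fin n) → Subset m → Subset n
image f A = subset (λ j → any? (λ u → (f u ≟ j) ×-dec (u ∈? A)))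

∈-preimage : ∀ {m n} (f : Fin m → Fin n) {A u} → u ∈ preimage f A ⇔ f u ∈ A
∈-preimage f {A} = ∈-subset (λ u → f u ∈? A)

∈-image : ∀ {m n} {f : Fin m → Fin n} → Injective _≡_ _≡_ f → ∀ {A u} → f u ∈ image f A ⇔ u ∈ A
∈-image {f = f} f-injective {A} {u} = mk⇔
  (λ fu∈ → let (v , fv≡fu , v∈A) = ⇒ (∈-subset image?) fu∈ in
            subst (_∈ A) (f-injective fv≡fu) v∈A)
  (λ u∈A → ⇐ (∈-subset image?) (u , refl , u∈A))
  where
  image? : Decidable (λ j → Σ (Fin _) (λ v → f v ≡ j × v ∈ A))
  image? j = any? (λ v → (f v ≟ j) ×-dec (v ∈? A))

relativise : ∀ {m s S} → (Fin s → Fin S) → Fin S → Formula m s → Formula m S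
relativise ι x (u ≐ v)  = u ≐ v
relativise ι x (u <₁ v) = u <₁ v
relativise ι x (u <₂ v) = u <₂ v
relativise ι x (u ∈ˢ Y) = u ∈ˢ ι Y
relativise ι x (¬ᶠ φ)   = ¬ᶠ relativise ι x φ
relativise ι x (φ ∧ᶠ ψ) = relativise ι x φ ∧ᶠ relativise ι x ψ
relativise ι x (∃₁ φ)   = ∃₁ ((zero ∈ˢ x) ∧ᶠ relativise ι x φ)
relativise ι x (∃₂ φ)   = ∃₂ (relativise (lift 1 ι) (suc x) φ)

record Occurrence {m n} (τ : Perm m) (π : Perm n) : Set where
  field
    point   : Fin m → Fin n
    x-order : ∀ u v → point u < point v ⇔ u < v
    y-order : ∀ u v → (π ⟨$⟩ʳ point u) < (π ⟨$⟩ʳ point v) ⇔ (τ ⟨$⟩ʳ u) < (τ ⟨$⟩ʳ v)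

  point-injective : Injective _≡_ _≡_ point
  point-injective {u} {v} eq with <-cmp u v
  ... | tri< u<v _ _ = contradiction (⇐ (x-order u v) u<v) (<-irrefl eq)
  ... | tri≈ _ u≡v _ = u≡v
  ... | tri> _ _ v<u = contradiction (⇐ (x-order v u) v<u) (<-irrefl (sym eq))

module _ {m n} {τ : Perm m} {π : Perm n} (occ : Occurrence τ π) where
  open Occurrence occ

  relativise-sat :
    ∀ {a s S} (ψ : Formula a s) {ι : Fin s → Fin S} {x : Fin S}
      {ρ : Fin a → Fin n} {ρ′ : Fin a → Fin m} {E : Fin S → Subset n} {σ′ : Fin s → Subset m} →
    (∀ z → ρ z ≡ point (ρ′ z)) →
    (∀ Y u → point u ∈ E (ι Y) ⇔ u ∈ σ′ Y) →
    (∀ j → j ∈ E x ⇔ Σ (Fin m) (λ u → point u ≡ j)) →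
    Sat π ρ E (relativise ι x ψ) ⇔ Sat τ ρ′ σ′ ψ
  relativise-sat (u ≐ v) hρ hσ hx rewrite hρ u | hρ v =
    mk⇔ point-injective (cong point)
  relativise-sat (u <₁ v) {ρ′ = ρ′} hρ hσ hx rewrite hρ u | hρ v = x-order (ρ′ u) (ρ′ v)
  relativise-sat (u <₂ v) {ρ′ = ρ′} hρ hσ hx rewrite hρ u | hρ v = y-order (ρ′ u) (ρ′ v)
  relativise-sat (u ∈ˢ Y) {ρ′ = ρ′} hρ hσ hx rewrite hρ u = hσ Y (ρ′ u)
  relativise-sat (¬ᶠ ψ) hρ hσ hx = ¬-cong-⇔ (relativise-sat ψ hρ hσ hx)
  relativise-sat (ψ ∧ᶠ χ) hρ hσ hx =
    let ψ⇔ = relativise-sat ψ hρ hσ hx ; χ⇔ = relativise-sat χ hρ hσ hx in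
    mk⇔ (λ (p , q) → ⇒ ψ⇔ p , ⇒ χ⇔ q) (λ (p , q) → ⇐ ψ⇔ p , ⇐ χ⇔ q)
  relativise-sat (∃₁ ψ) {ρ = ρ} {ρ′} hρ hσ hx = mk⇔
    (λ (j , j∈x , h) → let (u , pu≡j) = ⇒ (hx j) j∈x in
      u , ⇒ (relativise-sat ψ (extend-point (sym pu≡j)) hσ hx) h)
    (λ (u , h) →
      point u , ⇐ (hx (point u)) (u , refl) , ⇐ (relativise-sat ψ (extend-point refl) hσ hx) h)
    where
    extend-point : ∀ {j u} → j ≡ point u → ∀ z → extend j ρ z ≡ point (extend u ρ′ z)
    extend-point j≡pu zero    = j≡pu
    extend-point j≡pu (suc z) = hρ z
  relativise-sat (∃₂ ψ) {ι} {E = E} {σ′} hρ hσ hx = mk⇔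
    (λ (A , h) → preimage point A ,
       ⇒ (relativise-sat ψ hρ (extend-⇔ (⇔-sym (∈-preimage point))) hx) h)
    (λ (A′ , h) → image point A′ ,
       ⇐ (relativise-sat ψ hρ (extend-⇔ (∈-image point-injective)) hx) h)
    where
    extend-⇔ : ∀ {A A′} → (∀ {u} → point u ∈ A ⇔ u ∈ A′) →
               ∀ Y u → point u ∈ extend A E (lift 1 ι Y) ⇔ u ∈ extend A′ σ′ Y
    extend-⇔ hA zero    u = hA
    extend-⇔ hA (suc Y) u = hσ Y u

Enumeration : ∀ {n} → (Fin n → Set) → ℕ → Set
Enumeration {n} P m =
  Σ (Σ (Fin n) P ↔ Fin m) λ f → ∀ a b → proj₁ a < proj₁ b ⇔ Inverse.to f a < Inverse.to f b

module _ {n} {P : Fin (suc n) → Set} {m : ℕ} where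

  enumeration-skip : ¬ P zero → Enumeration (P ∘ suc) m → Enumeration P m
  enumeration-skip ¬p₀ (f , mono) = mk↔ₛ′ to from to∘from from∘to , mono′
    where
    open Inverse f using () renaming (to to f⁺; from to f⁻)
    to : Σ (Fin (suc n)) P → Fin m
    to (zero  , p) = contradiction p ¬p₀
    to (suc j , p) = f⁺ (j , p)
    from : Fin m → Σ (Fin (suc n)) P
    from u = suc (proj₁ (f⁻ u)) , proj₂ (f⁻ u)
    to∘from : ∀ u → to (from u) ≡ u
    to∘from = Inverse.strictlyInverseˡ f
    from∘to : ∀ a → from (to a) ≡ a
    from∘to (zero  , p) = contradiction p ¬p₀
    from∘to (suc j , p) = cong (λ (j′ , p′) → suc j′ , p′) (Inverse.strictlyInverseʳ f (j , p))
    mono′ : ∀ a b → proj₁ a < proj₁ b ⇔ to a < to b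
    mono′ (zero  , p) _           = contradiction p ¬p₀
    mono′ (suc _ , _) (zero  , p) = contradiction p ¬p₀
    mono′ (suc i , p) (suc j , q) =
      mk⇔ (λ { (s≤s i<j) → ⇒ (mono (i , p) (j , q)) i<j }) (s≤s ∘ ⇐ (mono (i , p) (j , q)))

  enumeration-keep : (p₀ : P zero) → (∀ p → p₀ ≡ p) →
                     Enumeration (P ∘ suc) m → Enumeration P (suc m)
  enumeration-keep p₀ p₀-unique (f , mono) = mk↔ₛ′ to from to∘from from∘to , mono′
    where
    open Inverse f using () renaming (to to f⁺; from to f⁻)
    to : Σ (Fin (suc n)) P → Fin (suc m)
    to (zero  , _) = zero
    to (suc j , p) = suc (f⁺ (j , p))
    from : Fin (suc m) → Σ (Fin (suc n)) P
    from zero    = zero , p₀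
    from (suc u) = suc (proj₁ (f⁻ u)) , proj₂ (f⁻ u)
    to∘from : ∀ u → to (from u) ≡ u
    to∘from zero    = refl
    to∘from (suc u) = cong suc (Inverse.strictlyInverseˡ f u)
    from∘to : ∀ a → from (to a) ≡ a
    from∘to (zero  , p) = cong (zero ,_) (p₀-unique p)
    from∘to (suc j , p) = cong (λ (j′ , p′) → suc j′ , p′) (Inverse.strictlyInverseʳ f (j , p))
    mono′ : ∀ a b → proj₁ a < proj₁ b ⇔ to a < to b
    mono′ (zero  , _) (zero  , _) = mk⇔ (λ ()) (λ ())
    mono′ (zero  , _) (suc _ , _) = mk⇔ (λ _ → s≤s z≤n) (λ _ → s≤s z≤n)
    mono′ (suc _ , _) (zero  , _) = mk⇔ (λ ()) (λ ())
    mono′ (suc i , p) (suc j , q) =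
      mk⇔ (λ { (s≤s i<j) → s≤s (⇒ (mono (i , p) (j , q)) i<j) })
          (λ { (s≤s i<j) → s≤s (⇐ (mono (i , p) (j , q)) i<j) })

enumerate : ∀ {n} {P : Fin n → Set} → Decidable P → Irrelevant P → Σ ℕ (Enumeration P)
enumerate {zero} P? irr =
  0 , mk↔ₛ′ (λ ()) (λ ()) (λ ()) (λ ()) , λ ()
enumerate {suc n} P? irr with enumerate (P? ∘ suc) irr | P? zero
... | m , e | yes p₀ = suc m , enumeration-keep p₀ (irr p₀) e
... | m , e | no ¬p₀ = m , enumeration-skip ¬p₀ e

Σ-reindex : ∀ {n} {P : Fin n → Set} (π : Perm n) → Irrelevant P →
            Σ (Fin n) P ↔ Σ (Fin n) (P ∘ (π ⟨$⟩ˡ_))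
Σ-reindex {P = P} π irr = mk↔ₛ′
  (λ (j , p) → π ⟨$⟩ʳ j , subst P (sym (inverseˡ π)) p)
  (λ (v , p) → π ⟨$⟩ˡ v , p)
  (λ _ → Σ-≡,≡→≡ (inverseʳ π , irr _ _))
  (λ _ → Σ-≡,≡→≡ (inverseˡ π , irr _ _))

-- Phrased with toℕ because m ≡ m′ holds only propositionally.
relabel : ∀ {A : Set} {m m′} (f : A ↔ Fin m) (g : A ↔ Fin m′) →
          Σ (Perm m) λ τ → ∀ a → toℕ (τ ⟨$⟩ʳ Inverse.to f a) ≡ toℕ (Inverse.to g a)
relabel f g with refl ← ↔⇒≡ (↔-trans (↔-sym f) g) =
  ↔-trans (↔-sym f) g , λ a → cong (toℕ ∘ Inverse.to g) (Inverse.strictlyInverseʳ f a)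

classIso-exists : ∀ {n k} (π : Perm n) (c : Fin n → Fin k) (i : Fin k) →
                  Σ ℕ λ m → Σ (Perm m) (ClassIso π c i)
classIso-exists π c i =
  let (m , f , x-mono) = enumerate (λ j → c j ≟ i) ≡-irrelevant
      (_ , g , y-mono) = enumerate (λ v → c (π ⟨$⟩ˡ v) ≟ i) ≡-irrelevant
      S = Σ-reindex π ≡-irrelevant
      (τ , τ-relabels) = relabel f (↔-trans S g)
      -- S sends a point of the class to its y-coordinate, so y-mono compares π-values.
      y-order = λ a b → subst₂ (λ x y → _ ⇔ x ℕ.< y) (sym (τ-relabels a)) (sym (τ-relabels b))
                                 (y-mono (Inverse.to S a) (Inverse.to S b))
  in m , τ , f , λ a b → x-mono a b , y-order a b
  where open Decidable⇒UIP _≟_ using (≡-irrelevant)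

module _ {n k m} {π : Perm n} {c : Fin n → Fin k} {i : Fin k} {τ : Perm m}
         (iso : ClassIso π c i τ) where
  open Inverse (proj₁ iso) using (to; from; strictlyInverseˡ; strictlyInverseʳ)

  classIso⇒occurrence : Occurrence τ π
  classIso⇒occurrence = record
    { point   = proj₁ ∘ from
    ; x-order = λ u v → cancel (λ u′ v′ → u′ < v′) u v (proj₁ (proj₂ iso (from u) (from v)))
    ; y-order = λ u v → cancel (λ u′ v′ → (τ ⟨$⟩ʳ u′) < (τ ⟨$⟩ʳ v′)) u v
                                (proj₂ (proj₂ iso (from u) (from v)))
    }
    where
    cancel : ∀ {B : Set} (R : Fin m → Fin m → Set) u v →
             B ⇔ R (to (from u)) (to (from v)) → B ⇔ R u v
    cancel R u v = subst₂ (λ u′ v′ → _ ⇔ R u′ v′) (strictlyInverseˡ u) (strictlyInverseˡ v)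

  open Occurrence classIso⇒occurrence using (point)

  class-⇔-image : ∀ j → c j ≡ i ⇔ Σ (Fin m) (λ u → point u ≡ j)
  class-⇔-image j = mk⇔
    (λ p → to (j , p) , cong proj₁ (strictlyInverseʳ (j , p)))
    (λ { (u , refl) → proj₂ (from u) })

  relativise-⊨ : ∀ {S} {x : Fin S} {ρ : Fin 0 → Fin n} {E : Fin S → Subset n} (φ : Sentence) →
                 (∀ j → j ∈ E x ⇔ c j ≡ i) → Sat π ρ E (relativise (λ ()) x φ) ⇔ τ ⊨ φ
  relativise-⊨ φ hx =
    relativise-sat classIso⇒occurrence φ (λ ()) (λ ()) (λ j → class-⇔-image j ⇔-∘ hx j)

ColourClasses : ∀ {n k} → (Fin k → Subset n) → (Fin n → Fin k) → Set
ColourClasses Xs c = ∀ i j → j ∈ Xs i ⇔ c j ≡ i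

Covered : ∀ {k m s} → (Fin k → Fin s) → Formula (suc m) s
Covered X = ⋁ λ i → zero ∈ˢ X i

InAtMostOne : ∀ {k m s} → (Fin k → Fin s) → Formula (suc m) s
InAtMostOne X = ⋀ λ i → ⋀ λ i′ → unless (i ≟ i′) (¬ᶠ ((zero ∈ˢ X i) ∧ᶠ (zero ∈ˢ X i′)))

Partition : ∀ {k m s} → (Fin k → Fin s) → Formula m s
Partition X = ∀ᶠ (Covered X ∧ᶠ InAtMostOne X)

module _ {n} {π : Perm n} {k m s} {ρ : Fin m → Fin n} {σ : Fin s → Subset n}
         (X : Fin k → Fin s) where

  Partition⇒ColourClasses : Sat π ρ σ (Partition X) → Σ (Fin n → Fin k) (ColourClasses (σ ∘ X))
  Partition⇒ColourClasses h = c , classes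
    where
    at : ∀ j → Sat π (extend j ρ) σ (Covered X ∧ᶠ InAtMostOne X)
    at = ⇒ (∀ᶠ-sat (Covered X ∧ᶠ InAtMostOne X)) h
    cover : ∀ j → Σ (Fin k) (λ i → j ∈ σ (X i))
    cover j = ⇒ (⋁-sat (λ i → zero ∈ˢ X i)) (proj₁ (at j))
    disjoint : ∀ j i i′ → ¬ i ≡ i′ → ¬ (j ∈ σ (X i) × j ∈ σ (X i′))
    disjoint j i i′ = ⇒ (unless-sat (i ≟ i′) _)
                        (⇒ (⋀-sat _) (⇒ (⋀-sat _) (proj₂ (at j)) i) i′)
    c : Fin n → Fin k
    c j = proj₁ (cover j)
    classes : ColourClasses (σ ∘ X) c
    classes i j = mk⇔
      (λ j∈i → decidable-stable (c j ≟ i) (λ c≢i → disjoint j (c j) i c≢i (proj₂ (cover j) , j∈i)))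
      (λ { refl → proj₂ (cover j) })

  ColourClasses⇒Partition : ∀ {c} → ColourClasses (σ ∘ X) c → Sat π ρ σ (Partition X)
  ColourClasses⇒Partition {c} classes = ⇐ (∀ᶠ-sat (Covered X ∧ᶠ InAtMostOne X)) λ j →
    ⇐ (⋁-sat (λ i → zero ∈ˢ X i)) (c j , ⇐ (classes (c j) j) refl) ,
    ⇐ (⋀-sat _) λ i → ⇐ (⋀-sat _) λ i′ → ⇐ (unless-sat (i ≟ i′) _) λ i≢i′ (j∈i , j∈i′) →
      i≢i′ (trans (sym (⇒ (classes i j) j∈i)) (⇒ (classes i′ j) j∈i′))

classVar : ∀ {k} → Fin k → Fin (k + 0)
classVar i = i ↑ˡ 0

mergeSentence : ∀ {k} → (Fin k → Sentence) → Sentence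
mergeSentence {k} φ =
  ∃₂* k 0 (Partition classVar ∧ᶠ ⋀ λ i → relativise (λ ()) (classVar i) (φ i))

module _ {n k} (π : Perm n) (φ : Fin k → Sentence) where

  mergeSentence-sound : π ⊨ mergeSentence φ → MergeOfModels π φ
  mergeSentence-sound h =
    let (_ , partition , relativised) = ⇒ (∃₂*-sat k 0 _) h
        (c , classes) = Partition⇒ColourClasses classVar partition
        iso = classIso-exists π c
    in proj₁ ∘ iso , proj₁ ∘ proj₂ ∘ iso , (c , proj₂ ∘ proj₂ ∘ iso) , λ i →
       ⇒ (relativise-⊨ (proj₂ (proj₂ (iso i))) (φ i) (classes i)) (⇒ (⋀-sat _) relativised i)

  mergeSentence-complete : MergeOfModels π φ → π ⊨ mergeSentence φ
  mergeSentence-complete (_ , _ , (c , isos) , models) =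
    ⇐ (∃₂*-sat k 0 _)
      (Xs , ColourClasses⇒Partition classVar classes ,
            ⇐ (⋀-sat _) λ i → ⇐ (relativise-⊨ (isos i) (φ i) (classes i)) (models i))
    where
    Xs : Fin k → Subset n
    Xs i = subset (λ j → c j ≟ i)
    classes : ∀ {σ} → ColourClasses ((Xs ++ᵉ σ) ∘ classVar) c
    classes {σ} i j rewrite ++ᵉ-↑ˡ Xs σ i = ∈-subset (λ j → c j ≟ i)

proposition2 : (k : ℕ) (φ : Fin k → Sentence) →
    Σ Sentence λ ρ → (n : ℕ) (π : Perm n) → ((π ⊨ ρ) ⇔ MergeOfModels π φ)
proposition2 k φ =
  mergeSentence φ , λ n π → mk⇔ (mergeSentence-sound π φ) (mergeSentence-complete π φ)
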